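{- The set of pairs $(r,z)$ of words over $\{0,1,2\}$ of the same length such that $z$ is a Chung-Graham word and $\mathrm{val}(r)=\mathrm{val}(z)$ (with $r$ an arbitrary word over $\{0,1,2\}$) is accepted by a finite automaton reading the two words in parallel, least significant digit first.
   Context: Fibonacci numbers: $F_0=0$, $F_1=1$, $F_{n+1}=F_n+F_{n-1}$ for $n\ge1$. For a word $a=a_0a_1\cdots a_{m-1}$ over $\{0,1,2\}$ (written least significant digit first), its value is $\mathrm{val}(a)=\sum_{i=0}^{m-1} a_iF_{i+2}$. A Chung-Graham word is a word over $\{0,1,2\}$ such that $a_i=0$ whenever $i$ is odd, and whenever $i<j$ are even indices with $a_i=a_j=2$ there is an even $k$ with $i<k<j$ and $a_k=0$. -}

module Defs where

open import Data.Nat using (ℕ; zero; suc; _+_; _*_; _<_; _%_)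
open import Data.Fin using (Fin; toℕ)
open import Data.List using (List; []; _∷_; length; lookup; foldl)
open import Data.Product using (Σ; _×_; _,_)
open import Data.Bool using (Bool; true)
open import Relation.Binary.PropositionalEquality using (_≡_)

Digit : Set
Digit = Fin 3

fib : ℕ → ℕ
fib zero = 0
fib (suc zero) = 1
fib (suc (suc n)) = fib (suc n) + fib n

valFrom : ℕ → List Digit → ℕ
valFrom i [] = 0
valFrom i (a ∷ as) = toℕ a * fib (i + 2) + valFrom (suc i) as

val : List Digit → ℕ
val = valFrom 0

IsChungGraham : List Digit → Set
IsChungGraham w =
  (∀ (i : Fin (length w)) → toℕ i % 2 ≡ 1 → toℕ (lookup w i) ≡ 0)
  × (∀ (i j : Fin (length w)) → toℕ i % 2 ≡ 0 → toℕ j % 2 ≡ 0 → toℕ i < toℕ j →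
       toℕ (lookup w i) ≡ 2 → toℕ (lookup w j) ≡ 2 →
       Σ (Fin (length w)) λ k → toℕ k % 2 ≡ 0 × toℕ i < toℕ k × toℕ k < toℕ j
                                × toℕ (lookup w k) ≡ 0)

record DFA (A : Set) : Set where
  field
    states : ℕ
    start  : Fin states
    step   : Fin states → A → Fin states
    accept : Fin states → Bool

run : {A : Set} → (M : DFA A) → List A → Fin (DFA.states M)
run M w = foldl (DFA.step M) (DFA.start M) w

Accepts : {A : Set} → DFA A → List A → Set
Accepts M w = DFA.accept M (run M w) ≡ true

{-# OPTIONS --safe #-}
module Submission where

-- The Chung-Graham condition is checked by a five-state automaton that tracks the parity of the
-- position and whether an even-position 2 is still waiting for an even-position 0.
--
-- For the values put d_k = r_k − z_k; the goal is Σ d_k F(k+2) = 0. Reading least significant digit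
-- first, the digits already read are summarised by a carry (a , b) standing for a F(i+2) + b F(i+3),
-- and the word is balanced when the final carry is 0. Read from the other end, a balanced word
-- determines all of its carries, and they stay in the box |a| ≤ 8, |b| ≤ 10 because two independent
-- linear forms in (a , b) stay small. So the carries fit in a finite automaton that discards any
-- carry leaving the box. The initial carry is only constrained by a + 2b = 0, so one copy of this
-- automaton is started from each such carry in the box.

open import Defs
open import Data.List using (List; map)
open import Data.Product using (Σ; _×_; proj₁; proj₂)
open import Function.Bundles using (_⇔_)
open import Relation.Binary.PropositionalEquality using (_≡_)

open import Data.Bool using (Bool; true; false; _∧_; _∨_)
open import Data.Empty using (⊥-elim)
open import Data.Fin using (Fin; zero; suc; toℕ; fromℕ<; combine; remQuot)
open import Data.Fin.Patterns using (0F; 1F; 2F; 3F; 4F)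
open import Data.Fin.Properties using (remQuot-combine; toℕ-fromℕ<; toℕ≤pred[n])
open import Data.Integer using (ℤ; +_; -[1+_]; 0ℤ; _+_; _-_; _*_; -_; ∣_∣; _⊖_)
open import Data.Integer.Properties
  using (pos-+; pos-*; abs-*; ∣-i∣≡∣i∣; ∣i+j∣≤∣i∣+∣j∣; ∣i-j∣≤∣i∣+∣j∣; ∣m⊝n∣≤m⊔n; ⊖-≥; m-n≡m⊖n;
         +-identityˡ; +-identityʳ; +-assoc; +-injective; i≡j⇒i-j≡0; i-j≡0⇒i≡j)
  renaming (_≟_ to _≟ℤ_)
open import Algebra.Properties.AbelianGroup Data.Integer.Properties.+-0-abelianGroup using (inverseˡ-unique)
open import Data.Integer.Tactic.RingSolver using (solve-∀)
open import Data.List using ([]; _∷_; length; foldl; lookup)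
open import Data.List.Properties using (foldl-map)
open import Data.Maybe using (Maybe; just; nothing; maybe; zip)
open import Data.Nat as ℕ using (ℕ; zero; suc; z≤n; s≤s; _%_; _<_)
import Data.Nat.Properties as ℕ
import Data.Nat.Tactic.RingSolver as ℕ-Solver
open import Data.Product using (_,_; ∃-syntax; uncurry)
import Data.Product as Product
open import Data.Product.Function.NonDependent.Propositional using (_×-⇔_)
open import Data.Product.Properties using (≡-dec)
open import Data.Sum using (_⊎_; inj₁; inj₂; [_,_]′)
open import Data.Unit using (⊤; tt)
open import Function using (_∘_; id; const)
open import Function.Bundles using (Equivalence; mk⇔)
open import Function.Properties.Equivalence using () renaming (trans to ⇔-trans; sym to ⇔-sym)
open import Relation.Nullary using (¬_; yes; no; does; contradiction)
open import Relation.Nullary.Decidable using (dec-true)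
open import Relation.Binary.PropositionalEquality using (refl; sym; trans; cong; cong₂; subst; module ≡-Reasoning)

open Equivalence using (to; from)

-- Finite automata

record Finite (Q : Set) : Set where
  field
    size          : ℕ
    encode        : Q → Fin size
    decode        : Fin size → Q
    decode-encode : ∀ q → decode (encode q) ≡ q

open Finite

finiteFin : ∀ n → Finite (Fin n)
finiteFin n = record { size = n ; encode = id ; decode = id ; decode-encode = λ _ → refl }

finite-× : {A B : Set} → Finite A → Finite B → Finite (A × B)
finite-× FA FB = record
  { size          = size FA ℕ.* size FB
  ; encode        = uncurry λ a b → combine (encode FA a) (encode FB b)
  ; decode        = Product.map (decode FA) (decode FB) ∘ remQuot {size FA} (size FB)
  ; decode-encode = uncurry λ a b →
      trans (cong (Product.map (decode FA) (decode FB)) (remQuot-combine (encode FA a) (encode FB b)))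
            (cong₂ _,_ (decode-encode FA a) (decode-encode FB b))
  }

finiteMaybe : {A : Set} → Finite A → Finite (Maybe A)
finiteMaybe FA = record
  { size          = suc (size FA)
  ; encode        = maybe (suc ∘ encode FA) zero
  ; decode        = λ { zero → nothing ; (suc i) → just (decode FA i) }
  ; decode-encode = λ { nothing → refl ; (just a) → cong just (decode-encode FA a) }
  }

≡true-cong : {a b : Bool} → a ≡ b → (a ≡ true) ⇔ (b ≡ true)
≡true-cong a≡b = mk⇔ (trans (sym a≡b)) (trans a≡b)

∧-≡-true : ∀ {a b} → (a ∧ b ≡ true) ⇔ (a ≡ true × b ≡ true)
∧-≡-true {true}  = mk⇔ (refl ,_) proj₂
∧-≡-true {false} = mk⇔ (λ ()) (λ { (() , _) })

∨-≡-true : ∀ {a b} → (a ∨ b ≡ true) ⇔ (a ≡ true ⊎ b ≡ true)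
∨-≡-true {true}  = mk⇔ inj₁ (const refl)
∨-≡-true {false} = mk⇔ inj₂ [ (λ ()) , id ]′

module _ {Q A : Set} (FQ : Finite Q) (q₀ : Q) (δ : Q → A → Q) (acc : Q → Bool) where

  private
    encodedStep : Fin (size FQ) → A → Fin (size FQ)
    encodedStep i x = encode FQ (δ (decode FQ i) x)

    decode-foldl : ∀ q w → decode FQ (foldl encodedStep (encode FQ q) w) ≡ foldl δ q w
    decode-foldl q []      = decode-encode FQ q
    decode-foldl q (x ∷ w) rewrite decode-encode FQ q = decode-foldl (δ q x) w

  -- Opaque: unfolding the encoded start state of a product of many automata is prohibitively expensive.
  opaque
    automaton : DFA A
    automaton = record { states = size FQ ; start = encode FQ q₀ ; step = encodedStep ; accept = acc ∘ decode FQ }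

  opaque
    unfolding automaton
    accept-automaton : ∀ w → DFA.accept automaton (run automaton w) ≡ acc (foldl δ q₀ w)
    accept-automaton w = cong acc (decode-foldl q₀ w)

  Accepts-automaton : ∀ w → Accepts automaton w ⇔ (acc (foldl δ q₀ w) ≡ true)
  Accepts-automaton w = ≡true-cong (accept-automaton w)

_⊗_ : {A B C : Set} → (A → C → A) → (B → C → B) → A × B → C → A × B
(f ⊗ g) (a , b) x = f a x , g b x

foldl-⊗ : {A B C : Set} (f : A → C → A) (g : B → C → B) →
          ∀ a b w → foldl (f ⊗ g) (a , b) w ≡ (foldl f a w , foldl g b w)
foldl-⊗ f g a b []      = refl
foldl-⊗ f g a b (x ∷ w) = foldl-⊗ f g (f a x) (g b x) w

module _ {A : Set} (_∙_ : Bool → Bool → Bool) (M N : DFA A) where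

  private
    finiteStates : Finite (Fin (DFA.states M) × Fin (DFA.states N))
    finiteStates = finite-× (finiteFin (DFA.states M)) (finiteFin (DFA.states N))

    acceptBoth : Fin (DFA.states M) × Fin (DFA.states N) → Bool
    acceptBoth (p , q) = DFA.accept M p ∙ DFA.accept N q

  product : DFA A
  product = automaton finiteStates (DFA.start M , DFA.start N) (DFA.step M ⊗ DFA.step N) acceptBoth

  accept-product : ∀ w → DFA.accept product (run product w) ≡ (DFA.accept M (run M w) ∙ DFA.accept N (run N w))
  accept-product w =
    trans (accept-automaton finiteStates (DFA.start M , DFA.start N) (DFA.step M ⊗ DFA.step N) acceptBoth w)
          (cong acceptBoth (foldl-⊗ (DFA.step M) (DFA.step N) (DFA.start M) (DFA.start N) w))

module _ {A : Set} where

  _∩_ _∪_ : DFA A → DFA A → DFA A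
  _∩_ = product _∧_
  _∪_ = product _∨_

  Accepts-∩ : ∀ M N w → Accepts (M ∩ N) w ⇔ (Accepts M w × Accepts N w)
  Accepts-∩ M N w = ⇔-trans (≡true-cong (accept-product _∧_ M N w)) ∧-≡-true

  Accepts-∪ : ∀ M N w → Accepts (M ∪ N) w ⇔ (Accepts M w ⊎ Accepts N w)
  Accepts-∪ M N w = ⇔-trans (≡true-cong (accept-product _∨_ M N w)) ∨-≡-true

  ∅ : DFA A
  ∅ = record { states = 1 ; start = 0F ; step = λ _ _ → 0F ; accept = const false }

  ⋃ : ∀ {n} → (Fin n → DFA A) → DFA A
  ⋃ {zero}  M = ∅
  ⋃ {suc n} M = M 0F ∪ ⋃ (M ∘ suc)

  Accepts-⋃ : ∀ {n} (M : Fin n → DFA A) w → Accepts (⋃ M) w ⇔ (∃[ c ] Accepts (M c) w)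
  Accepts-⋃ {zero}  M w = mk⇔ (λ ()) (λ { (() , _) })
  Accepts-⋃ {suc n} M w = ⇔-trans (Accepts-∪ (M 0F) (⋃ (M ∘ suc)) w) (mk⇔
    [ (0F ,_) , Product.map suc id ∘ to (Accepts-⋃ (M ∘ suc) w) ]′
    λ { (0F , h) → inj₁ h ; (suc c , h) → inj₂ (from (Accepts-⋃ (M ∘ suc) w) (c , h)) })

comap : {A B : Set} → (A → B) → DFA B → DFA A
comap f M = record
  { states = DFA.states M ; start = DFA.start M ; step = λ q x → DFA.step M q (f x) ; accept = DFA.accept M }

Accepts-comap : {A B : Set} (f : A → B) (M : DFA B) → ∀ w → Accepts (comap f M) w ⇔ Accepts M (map f w)
Accepts-comap f M w = ≡true-cong (cong (DFA.accept M) (sym (foldl-map (DFA.step M) f (DFA.start M) w)))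

-- Chung-Graham words

OddPositionsZero : List Digit → Set
OddPositionsZero w = ∀ (i : Fin (length w)) → toℕ i % 2 ≡ 1 → toℕ (lookup w i) ≡ 0

TwosSeparated : List Digit → Set
TwosSeparated w = ∀ (i j : Fin (length w)) → toℕ i % 2 ≡ 0 → toℕ j % 2 ≡ 0 → toℕ i < toℕ j →
  toℕ (lookup w i) ≡ 2 → toℕ (lookup w j) ≡ 2 →
  Σ (Fin (length w)) λ k → toℕ k % 2 ≡ 0 × toℕ i < toℕ k × toℕ k < toℕ j × toℕ (lookup w k) ≡ 0

ZeroBeforeEachTwo : List Digit → Set
ZeroBeforeEachTwo w = ∀ (j : Fin (length w)) → toℕ j % 2 ≡ 0 → toℕ (lookup w j) ≡ 2 →
  Σ (Fin (length w)) λ k → toℕ k % 2 ≡ 0 × toℕ k < toℕ j × toℕ (lookup w k) ≡ 0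

oddPositionsZero-∷∷ : ∀ x y zs → OddPositionsZero (x ∷ y ∷ zs) ⇔ (toℕ y ≡ 0 × OddPositionsZero zs)
oddPositionsZero-∷∷ x y zs = mk⇔ (λ odd → odd 1F refl , λ i → odd (suc (suc i))) extend
  where
  extend : toℕ y ≡ 0 × OddPositionsZero zs → OddPositionsZero (x ∷ y ∷ zs)
  extend (y-zero , _)   1F            _     = y-zero
  extend (_      , odd) (suc (suc i)) i-odd = odd i i-odd

twosSeparated-∷∷ : ∀ x y zs →
  TwosSeparated (x ∷ y ∷ zs) ⇔ (TwosSeparated zs × (toℕ x ≡ 2 → ZeroBeforeEachTwo zs))
twosSeparated-∷∷ x y zs = mk⇔ (λ sep → separated sep , guarded sep) extend
  where
  separated : TwosSeparated (x ∷ y ∷ zs) → TwosSeparated zs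
  separated sep i j i-even j-even i<j i-two j-two
    with sep (suc (suc i)) (suc (suc j)) i-even j-even (s≤s (s≤s i<j)) i-two j-two
  ... | 1F          , _      , s≤s ()          , _
  ... | suc (suc k) , k-even , s≤s (s≤s i<k) , s≤s (s≤s k<j) , k-zero = k , k-even , i<k , k<j , k-zero

  guarded : TwosSeparated (x ∷ y ∷ zs) → toℕ x ≡ 2 → ZeroBeforeEachTwo zs
  guarded sep x-two j j-even j-two with sep 0F (suc (suc j)) refl j-even (s≤s z≤n) x-two j-two
  ... | 1F          , ()
  ... | suc (suc k) , k-even , _ , s≤s (s≤s k<j) , k-zero = k , k-even , k<j , k-zero

  extend : TwosSeparated zs × (toℕ x ≡ 2 → ZeroBeforeEachTwo zs) → TwosSeparated (x ∷ y ∷ zs)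
  extend (sep , guard) 0F (suc (suc j)) _ j-even _ x-two j-two with guard x-two j j-even j-two
  ... | k , k-even , k<j , k-zero = suc (suc k) , k-even , s≤s z≤n , s≤s (s≤s k<j) , k-zero
  extend (sep , guard) (suc (suc i)) (suc (suc j)) i-even j-even (s≤s (s≤s i<j)) i-two j-two
    with sep i j i-even j-even i<j i-two j-two
  ... | k , k-even , i<k , k<j , k-zero = suc (suc k) , k-even , s≤s (s≤s i<k) , s≤s (s≤s k<j) , k-zero

isChungGraham-[] : IsChungGraham []
isChungGraham-[] = (λ ()) , (λ ())

isChungGraham-[_] : ∀ x → IsChungGraham (x ∷ [])
isChungGraham-[ x ] = (λ { 0F () }) , (λ { 0F 0F _ _ () })

isChungGraham-∷∷ : ∀ x y zs →
  IsChungGraham (x ∷ y ∷ zs) ⇔ (toℕ y ≡ 0 × IsChungGraham zs × (toℕ x ≡ 2 → ZeroBeforeEachTwo zs))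
isChungGraham-∷∷ x y zs = mk⇔
  (λ (odd , sep) → let (y-zero , odd′) = to odds odd ; (sep′ , guard) = to twos sep
                   in y-zero , (odd′ , sep′) , guard)
  (λ (y-zero , (odd′ , sep′) , guard) → from odds (y-zero , odd′) , from twos (sep′ , guard))
  where
  odds = oddPositionsZero-∷∷ x y zs
  twos = twosSeparated-∷∷ x y zs

zeroBeforeEachTwo-[] : ZeroBeforeEachTwo []
zeroBeforeEachTwo-[] = λ ()

zeroBeforeEachTwo-0∷ : ∀ ys → ZeroBeforeEachTwo (0F ∷ ys)
zeroBeforeEachTwo-0∷ ys (suc j) _ _ = 0F , refl , s≤s z≤n , refl

zeroBeforeEachTwo-[1] : ZeroBeforeEachTwo (1F ∷ [])
zeroBeforeEachTwo-[1] 0F _ ()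

zeroBeforeEachTwo-1∷∷ : ∀ y zs → ZeroBeforeEachTwo (1F ∷ y ∷ zs) ⇔ ZeroBeforeEachTwo zs
zeroBeforeEachTwo-1∷∷ y zs = mk⇔ restrict extend
  where
  restrict : ZeroBeforeEachTwo (1F ∷ y ∷ zs) → ZeroBeforeEachTwo zs
  restrict guard j j-even j-two with guard (suc (suc j)) j-even j-two
  ... | 1F          , ()
  ... | suc (suc k) , k-even , s≤s (s≤s k<j) , k-zero = k , k-even , k<j , k-zero

  extend : ZeroBeforeEachTwo zs → ZeroBeforeEachTwo (1F ∷ y ∷ zs)
  extend guard (suc (suc j)) j-even j-two with guard j j-even j-two
  ... | k , k-even , k<j , k-zero = suc (suc k) , k-even , s≤s (s≤s k<j) , k-zero

¬zeroBeforeEachTwo-2∷ : ∀ ys → ¬ ZeroBeforeEachTwo (2F ∷ ys)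
¬zeroBeforeEachTwo-2∷ ys guard with guard 0F refl refl
... | _ , _ , () , _

-- In even p and odd p the next position is even, resp. odd, and p records an even-position 2 that
-- is not yet followed by an even-position 0.
data CGState : Set where
  even odd : Bool → CGState
  dead     : CGState

cgStep : CGState → Digit → CGState
cgStep (even _)       0F      = odd false
cgStep (even pending) 1F      = odd pending
cgStep (even false)   2F      = odd true
cgStep (even true)    2F      = dead
cgStep (odd pending)  0F      = even pending
cgStep (odd _)        (suc _) = dead
cgStep dead           _       = dead

alive : CGState → Bool
alive dead = false
alive _    = true

finiteCGState : Finite CGState
finiteCGState = record { size = 5 ; encode = enc ; decode = dec ; decode-encode = dec-enc }
  where
  enc : CGState → Fin 5
  enc (even false) = 0F
  enc (even true)  = 1F
  enc (odd false)  = 2F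
  enc (odd true)   = 3F
  enc dead         = 4F

  dec : Fin 5 → CGState
  dec 0F = even false
  dec 1F = even true
  dec 2F = odd false
  dec 3F = odd true
  dec 4F = dead

  dec-enc : ∀ s → dec (enc s) ≡ s
  dec-enc (even false) = refl
  dec-enc (even true)  = refl
  dec-enc (odd false)  = refl
  dec-enc (odd true)   = refl
  dec-enc dead         = refl

chungGrahamDFA : DFA Digit
chungGrahamDFA = automaton finiteCGState (even false) cgStep alive

dead-rejects : ∀ zs → ¬ alive (foldl cgStep dead zs) ≡ true
dead-rejects []       ()
dead-rejects (_ ∷ zs) = dead-rejects zs

-- What the rest of the input must satisfy for acceptance from even pending, resp. odd pending.
CGFromEven : Bool → List Digit → Set
CGFromEven pending zs = IsChungGraham zs × (pending ≡ true → ZeroBeforeEachTwo zs)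

CGFromOdd : Bool → List Digit → Set
CGFromOdd pending []       = ⊤
CGFromOdd pending (y ∷ zs) = toℕ y ≡ 0 × CGFromEven pending zs

cgFromEven-0∷ : ∀ pending ys → CGFromEven pending (0F ∷ ys) ⇔ CGFromOdd false ys
cgFromEven-0∷ _ []       = mk⇔ (const tt) (const (isChungGraham-[ 0F ] , const (zeroBeforeEachTwo-0∷ [])))
cgFromEven-0∷ _ (y ∷ zs) = mk⇔
  (λ (cg , _) → let (y-zero , cg′ , _) = to (isChungGraham-∷∷ 0F y zs) cg in y-zero , cg′ , λ ())
  (λ (y-zero , cg′ , _) → from (isChungGraham-∷∷ 0F y zs) (y-zero , cg′ , λ ()) , const (zeroBeforeEachTwo-0∷ _))

cgFromEven-1∷ : ∀ pending ys → CGFromEven pending (1F ∷ ys) ⇔ CGFromOdd pending ys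
cgFromEven-1∷ _ []       = mk⇔ (const tt) (const (isChungGraham-[ 1F ] , const zeroBeforeEachTwo-[1]))
cgFromEven-1∷ _ (y ∷ zs) = mk⇔
  (λ (cg , guard) → let (y-zero , cg′ , _) = to (isChungGraham-∷∷ 1F y zs) cg
                    in y-zero , cg′ , to (zeroBeforeEachTwo-1∷∷ y zs) ∘ guard)
  (λ (y-zero , cg′ , guard) → from (isChungGraham-∷∷ 1F y zs) (y-zero , cg′ , λ ())
                            , from (zeroBeforeEachTwo-1∷∷ y zs) ∘ guard)

cgFromEven-2∷ : ∀ ys → CGFromEven false (2F ∷ ys) ⇔ CGFromOdd true ys
cgFromEven-2∷ []       = mk⇔ (const tt) (const (isChungGraham-[ 2F ] , λ ()))
cgFromEven-2∷ (y ∷ zs) = mk⇔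
  (λ (cg , _) → let (y-zero , cg′ , guard) = to (isChungGraham-∷∷ 2F y zs) cg in y-zero , cg′ , const (guard refl))
  (λ (y-zero , cg′ , guard) → from (isChungGraham-∷∷ 2F y zs) (y-zero , cg′ , const (guard refl)) , λ ())

¬cgFromEven-true-2∷ : ∀ ys → ¬ CGFromEven true (2F ∷ ys)
¬cgFromEven-true-2∷ ys (_ , guard) = ¬zeroBeforeEachTwo-2∷ ys (guard refl)

alive-even : ∀ pending zs → alive (foldl cgStep (even pending) zs) ≡ true ⇔ CGFromEven pending zs
alive-odd  : ∀ pending ys → alive (foldl cgStep (odd pending) ys) ≡ true ⇔ CGFromOdd pending ys

alive-even _     []        = mk⇔ (const (isChungGraham-[] , const zeroBeforeEachTwo-[])) (const refl)
alive-even p     (0F ∷ ys) = ⇔-trans (alive-odd false ys) (⇔-sym (cgFromEven-0∷ p ys))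
alive-even p     (1F ∷ ys) = ⇔-trans (alive-odd p ys) (⇔-sym (cgFromEven-1∷ p ys))
alive-even false (2F ∷ ys) = ⇔-trans (alive-odd true ys) (⇔-sym (cgFromEven-2∷ ys))
alive-even true  (2F ∷ ys) = mk⇔ (⊥-elim ∘ dead-rejects ys) (⊥-elim ∘ ¬cgFromEven-true-2∷ ys)

alive-odd _ []             = mk⇔ (const tt) (const refl)
alive-odd p (0F ∷ zs)      = ⇔-trans (alive-even p zs) (mk⇔ (refl ,_) proj₂)
alive-odd _ (suc _ ∷ zs)   = mk⇔ (⊥-elim ∘ dead-rejects zs) (λ { (() , _) })

chungGrahamDFA-correct : ∀ zs → Accepts chungGrahamDFA zs ⇔ IsChungGraham zs
chungGrahamDFA-correct zs =
  ⇔-trans (Accepts-automaton finiteCGState (even false) cgStep alive zs)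
          (⇔-trans (alive-even false zs) (mk⇔ proj₁ (_, λ ())))

-- Fibonacci carries

F : ℕ → ℤ
F n = + fib n

F-rec : ∀ n → F (2 ℕ.+ n) ≡ F (1 ℕ.+ n) + F n
F-rec n = pos-+ (fib (suc n)) (fib n)

fib-pos : ∀ n → 1 ℕ.≤ fib (suc n)
fib-pos zero    = ℕ.≤-refl
fib-pos (suc n) = ℕ.≤-trans (fib-pos n) (ℕ.m≤m+n (fib (suc n)) (fib n))

fib-mono : ∀ n → fib n ℕ.≤ fib (suc n)
fib-mono zero    = z≤n
fib-mono (suc n) = ℕ.m≤m+n (fib (suc n)) (fib n)

digitDiff : Digit × Digit → ℤ
digitDiff (r , z) = toℕ r ⊖ toℕ z

∣digitDiff*F∣≤ : ∀ x n → ∣ digitDiff x * F n ∣ ℕ.≤ 2 ℕ.* fib n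
∣digitDiff*F∣≤ (r , z) n = begin
  ∣ (toℕ r ⊖ toℕ z) * F n ∣    ≡⟨ abs-* (toℕ r ⊖ toℕ z) (F n) ⟩
  ∣ toℕ r ⊖ toℕ z ∣ ℕ.* fib n  ≤⟨ ℕ.*-monoˡ-≤ (fib n) ∣r⊖z∣≤2 ⟩
  2 ℕ.* fib n                  ∎
  where
  open ℕ.≤-Reasoning
  ∣r⊖z∣≤2 : ∣ toℕ r ⊖ toℕ z ∣ ℕ.≤ 2
  ∣r⊖z∣≤2 = ℕ.≤-trans (∣m⊝n∣≤m⊔n (toℕ r) (toℕ z)) (ℕ.⊔-lub (toℕ≤pred[n] r) (toℕ≤pred[n] z))

diffFrom : ℕ → List (Digit × Digit) → ℤ
diffFrom i []       = 0ℤ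
diffFrom i (x ∷ xs) = digitDiff x * F (2 ℕ.+ i) + diffFrom (suc i) xs

pos-valFrom-∷ : ∀ i a as → + valFrom i (a ∷ as) ≡ + toℕ a * F (2 ℕ.+ i) + + valFrom (suc i) as
pos-valFrom-∷ i a as = begin
  + (toℕ a ℕ.* fib (i ℕ.+ 2) ℕ.+ valFrom (suc i) as)   ≡⟨ pos-+ (toℕ a ℕ.* fib (i ℕ.+ 2)) _ ⟩
  + (toℕ a ℕ.* fib (i ℕ.+ 2)) + + valFrom (suc i) as    ≡⟨ cong (_+ _) (pos-* (toℕ a) (fib (i ℕ.+ 2))) ⟩
  + toℕ a * F (i ℕ.+ 2) + + valFrom (suc i) as          ≡⟨ cong (λ k → + toℕ a * F k + + valFrom (suc i) as) (ℕ.+-comm i 2) ⟩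
  + toℕ a * F (2 ℕ.+ i) + + valFrom (suc i) as          ∎
  where open ≡-Reasoning

diffFrom-valFrom : ∀ i w → diffFrom i w ≡ + valFrom i (map proj₁ w) - + valFrom i (map proj₂ w)
diffFrom-valFrom i []            = refl
diffFrom-valFrom i ((r , z) ∷ w) = begin
  (toℕ r ⊖ toℕ z) * F (2 ℕ.+ i) + diffFrom (suc i) w
    ≡⟨ cong₂ (λ d e → d * F (2 ℕ.+ i) + e) (sym (m-n≡m⊖n (toℕ r) (toℕ z))) (diffFrom-valFrom (suc i) w) ⟩
  (+ toℕ r - + toℕ z) * F (2 ℕ.+ i) + (R - Z)
    ≡⟨ distrib (+ toℕ r) (+ toℕ z) (F (2 ℕ.+ i)) R Z ⟩
  (+ toℕ r * F (2 ℕ.+ i) + R) - (+ toℕ z * F (2 ℕ.+ i) + Z)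
    ≡⟨ sym (cong₂ _-_ (pos-valFrom-∷ i r (map proj₁ w)) (pos-valFrom-∷ i z (map proj₂ w))) ⟩
  + valFrom i (r ∷ map proj₁ w) - + valFrom i (z ∷ map proj₂ w)
    ∎
  where
  open ≡-Reasoning
  R = + valFrom (suc i) (map proj₁ w)
  Z = + valFrom (suc i) (map proj₂ w)
  distrib : ∀ r z f R Z → (r - z) * f + (R - Z) ≡ (r * f + R) - (z * f + Z)
  distrib = solve-∀

val≡val⇔diffFrom≡0 : ∀ w → (val (map proj₁ w) ≡ val (map proj₂ w)) ⇔ (diffFrom 0 w ≡ 0ℤ)
val≡val⇔diffFrom≡0 w = mk⇔
  (λ eq → trans (diffFrom-valFrom 0 w) (i≡j⇒i-j≡0 (cong +_ eq)))
  (λ eq → +-injective (i-j≡0⇒i≡j _ _ (trans (sym (diffFrom-valFrom 0 w)) eq)))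

carryValue : ℕ → ℤ × ℤ → ℤ
carryValue i (a , b) = a * F (2 ℕ.+ i) + b * F (3 ℕ.+ i)

-- Absorbs a digit difference d at position i, using F(i+2) = F(i+4) − F(i+3).
carry : ℤ × ℤ → ℤ → ℤ × ℤ
carry (a , b) d = b - a - d , a + d

uncarry : ℤ × ℤ → ℤ → ℤ × ℤ
uncarry (a , b) d = b - d , a + b

carry-uncarry : ∀ p d → carry (uncarry p d) d ≡ p
carry-uncarry (a , b) d = cong₂ _,_ (cancel₁ a b d) (cancel₂ b d)
  where
  cancel₁ : ∀ a b d → a + b - (b - d) - d ≡ a
  cancel₁ = solve-∀
  cancel₂ : ∀ b d → b - d + d ≡ b
  cancel₂ = solve-∀

carryValue-carry : ∀ i p d → carryValue (suc i) (carry p d) ≡ carryValue i p + d * F (2 ℕ.+ i)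
carryValue-carry i (a , b) d = begin
  (b - a - d) * F (3 ℕ.+ i) + (a + d) * F (4 ℕ.+ i)
    ≡⟨ cong (λ f → (b - a - d) * F (3 ℕ.+ i) + (a + d) * f) (F-rec (2 ℕ.+ i)) ⟩
  (b - a - d) * F (3 ℕ.+ i) + (a + d) * (F (3 ℕ.+ i) + F (2 ℕ.+ i))
    ≡⟨ identity a b d (F (2 ℕ.+ i)) (F (3 ℕ.+ i)) ⟩
  a * F (2 ℕ.+ i) + b * F (3 ℕ.+ i) + d * F (2 ℕ.+ i)
    ∎
  where
  open ≡-Reasoning
  identity : ∀ a b d f₂ f₃ → (b - a - d) * f₃ + (a + d) * (f₃ + f₂) ≡ a * f₂ + b * f₃ + d * f₂
  identity = solve-∀

carryValue-step : ∀ i p x xs →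
  carryValue i p + diffFrom i (x ∷ xs) ≡ carryValue (suc i) (carry p (digitDiff x)) + diffFrom (suc i) xs
carryValue-step i p x xs = begin
  carryValue i p + (d * F (2 ℕ.+ i) + diffFrom (suc i) xs)  ≡⟨ sym (+-assoc (carryValue i p) _ _) ⟩
  carryValue i p + d * F (2 ℕ.+ i) + diffFrom (suc i) xs    ≡⟨ cong (_+ diffFrom (suc i) xs) (sym (carryValue-carry i p d)) ⟩
  carryValue (suc i) (carry p d) + diffFrom (suc i) xs      ∎
  where
  open ≡-Reasoning
  d = digitDiff x

requiredCarry : List (Digit × Digit) → ℤ × ℤ
requiredCarry []       = 0ℤ , 0ℤ
requiredCarry (x ∷ xs) = uncarry (requiredCarry xs) (digitDiff x)

requiredCarry-balances : ∀ i xs → carryValue i (requiredCarry xs) + diffFrom i xs ≡ 0ℤ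
requiredCarry-balances i []       = refl
requiredCarry-balances i (x ∷ xs) = begin
  carryValue i (uncarry p d) + diffFrom i (x ∷ xs)          ≡⟨ carryValue-step i (uncarry p d) x xs ⟩
  carryValue (suc i) (carry (uncarry p d) d) + diffFrom (suc i) xs
    ≡⟨ cong (λ q → carryValue (suc i) q + diffFrom (suc i) xs) (carry-uncarry p d) ⟩
  carryValue (suc i) p + diffFrom (suc i) xs                ≡⟨ requiredCarry-balances (suc i) xs ⟩
  0ℤ                                                        ∎
  where
  open ≡-Reasoning
  p = requiredCarry xs
  d = digitDiff x

-- Up to sign, the value of the carry at position −(n+3) when F is extended by F(−k) = (−1)^(k+1) F(k).
-- For the required carry of a word of length n this is a combination of its digit differences with
-- coefficients ±F(2), …, ±F(n+1), hence small.
dualValue : ℕ → ℤ × ℤ → ℤ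
dualValue n (a , b) = a * F (1 ℕ.+ n) - b * F n

dualValue-uncarry : ∀ n p d → dualValue (suc n) (uncarry p d) ≡ - dualValue n p - d * F (2 ℕ.+ n)
dualValue-uncarry n (a , b) d = begin
  (b - d) * F (2 ℕ.+ n) - (a + b) * F (1 ℕ.+ n)
    ≡⟨ cong (λ f → (b - d) * f - (a + b) * F (1 ℕ.+ n)) (F-rec n) ⟩
  (b - d) * (F (1 ℕ.+ n) + F n) - (a + b) * F (1 ℕ.+ n)
    ≡⟨ identity a b d (F (1 ℕ.+ n)) (F n) ⟩
  - (a * F (1 ℕ.+ n) - b * F n) - d * (F (1 ℕ.+ n) + F n)
    ≡⟨ cong (λ f → - dualValue n (a , b) - d * f) (sym (F-rec n)) ⟩
  - dualValue n (a , b) - d * F (2 ℕ.+ n)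
    ∎
  where
  open ≡-Reasoning
  identity : ∀ a b d f₁ f₀ → (b - d) * (f₁ + f₀) - (a + b) * f₁ ≡ - (a * f₁ - b * f₀) - d * (f₁ + f₀)
  identity = solve-∀

dualValue-requiredCarry : ∀ xs → ∣ dualValue (length xs) (requiredCarry xs) ∣ ℕ.≤ 2 ℕ.* fib (3 ℕ.+ length xs)
dualValue-requiredCarry []       = z≤n
dualValue-requiredCarry (x ∷ xs) = begin
  ∣ dualValue (suc n) (uncarry p d) ∣              ≡⟨ cong ∣_∣ (dualValue-uncarry n p d) ⟩
  ∣ - dualValue n p - d * F (2 ℕ.+ n) ∣            ≤⟨ ∣i-j∣≤∣i∣+∣j∣ (- dualValue n p) (d * F (2 ℕ.+ n)) ⟩
  ∣ - dualValue n p ∣ ℕ.+ ∣ d * F (2 ℕ.+ n) ∣      ≡⟨ cong (ℕ._+ ∣ d * F (2 ℕ.+ n) ∣) (∣-i∣≡∣i∣ (dualValue n p)) ⟩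
  ∣ dualValue n p ∣ ℕ.+ ∣ d * F (2 ℕ.+ n) ∣
    ≤⟨ ℕ.+-mono-≤ (dualValue-requiredCarry xs) (∣digitDiff*F∣≤ x (2 ℕ.+ n)) ⟩
  2 ℕ.* fib (3 ℕ.+ n) ℕ.+ 2 ℕ.* fib (2 ℕ.+ n)      ≡⟨ sym (ℕ.*-distribˡ-+ 2 (fib (3 ℕ.+ n)) (fib (2 ℕ.+ n))) ⟩
  2 ℕ.* fib (4 ℕ.+ n)                              ∎
  where
  open ℕ.≤-Reasoning
  n = length xs
  p = requiredCarry xs
  d = digitDiff x

InBox : ℤ × ℤ → Set
InBox (a , b) = ∣ a ∣ ℕ.≤ 8 × ∣ b ∣ ℕ.≤ 10

-- The two forms are independent, with determinant F(n+1) F(i+3) + F(i+2) F(n) > 0: Cramer's rule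
-- bounds a, and then the first form bounds b.
carry-bounded : ∀ i n p →
  ∣ carryValue i p ∣ ℕ.≤ 2 ℕ.* fib (3 ℕ.+ i) → ∣ dualValue n p ∣ ℕ.≤ 2 ℕ.* fib (3 ℕ.+ n) → InBox p
carry-bounded i n (a , b) P≤ X≤ = ∣a∣≤8 , ∣b∣≤10
  where
  P = carryValue i (a , b)
  X = dualValue n (a , b)
  f₀ = fib n
  f₁ = fib (1 ℕ.+ n)
  g₂ = fib (2 ℕ.+ i)
  g₃ = fib (3 ℕ.+ i)
  det = f₁ ℕ.* g₃ ℕ.+ g₂ ℕ.* f₀

  instance
    det-nonZero : ℕ.NonZero det
    det-nonZero = ℕ.>-nonZero (ℕ.≤-trans (ℕ.*-mono-≤ (fib-pos n) (fib-pos (2 ℕ.+ i))) (ℕ.m≤m+n _ _))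
    g₃-nonZero : ℕ.NonZero g₃
    g₃-nonZero = ℕ.>-nonZero (fib-pos (2 ℕ.+ i))

  cramer : a * + det ≡ X * F (3 ℕ.+ i) + P * F n
  cramer = begin
    a * + det                                           ≡⟨ cong (a *_) (trans (pos-+ (f₁ ℕ.* g₃) _) (cong₂ _+_ (pos-* f₁ g₃) (pos-* g₂ f₀))) ⟩
    a * (F (1 ℕ.+ n) * F (3 ℕ.+ i) + F (2 ℕ.+ i) * F n) ≡⟨ identity a b (F (1 ℕ.+ n)) (F n) (F (2 ℕ.+ i)) (F (3 ℕ.+ i)) ⟩
    X * F (3 ℕ.+ i) + P * F n                           ∎
    where
    open ≡-Reasoning
    identity : ∀ a b x₁ x₀ y₂ y₃ → a * (x₁ * y₃ + y₂ * x₀) ≡ (a * x₁ - b * x₀) * y₃ + (a * y₂ + b * y₃) * x₀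
    identity = solve-∀

  ∣a∣≤8 : ∣ a ∣ ℕ.≤ 8
  ∣a∣≤8 = ℕ.*-cancelʳ-≤ ∣ a ∣ 8 det (begin
    ∣ a ∣ ℕ.* det                                       ≡⟨ sym (abs-* a (+ det)) ⟩
    ∣ a * + det ∣                                       ≡⟨ cong ∣_∣ cramer ⟩
    ∣ X * F (3 ℕ.+ i) + P * F n ∣                       ≤⟨ ∣i+j∣≤∣i∣+∣j∣ (X * F (3 ℕ.+ i)) (P * F n) ⟩
    ∣ X * F (3 ℕ.+ i) ∣ ℕ.+ ∣ P * F n ∣                 ≡⟨ cong₂ ℕ._+_ (abs-* X (F (3 ℕ.+ i))) (abs-* P (F n)) ⟩
    ∣ X ∣ ℕ.* g₃ ℕ.+ ∣ P ∣ ℕ.* f₀                        ≤⟨ ℕ.+-mono-≤ (ℕ.*-monoˡ-≤ g₃ X≤) (ℕ.*-monoˡ-≤ f₀ P≤) ⟩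
    2 ℕ.* fib (3 ℕ.+ n) ℕ.* g₃ ℕ.+ 2 ℕ.* g₃ ℕ.* f₀      ≡⟨ collect f₁ f₀ g₃ ⟩
    4 ℕ.* ((f₁ ℕ.+ f₀) ℕ.* g₃)                          ≤⟨ ℕ.*-monoʳ-≤ 4 (ℕ.*-monoˡ-≤ g₃ (ℕ.+-monoʳ-≤ f₁ (fib-mono n))) ⟩
    4 ℕ.* ((f₁ ℕ.+ f₁) ℕ.* g₃)                          ≡⟨ double f₁ g₃ ⟩
    8 ℕ.* (f₁ ℕ.* g₃)                                   ≤⟨ ℕ.*-monoʳ-≤ 8 (ℕ.m≤m+n (f₁ ℕ.* g₃) (g₂ ℕ.* f₀)) ⟩
    8 ℕ.* det                                           ∎)
    where
    open ℕ.≤-Reasoning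
    collect : ∀ x₁ x₀ y → 2 ℕ.* ((x₁ ℕ.+ x₀) ℕ.+ x₁) ℕ.* y ℕ.+ 2 ℕ.* y ℕ.* x₀ ≡ 4 ℕ.* ((x₁ ℕ.+ x₀) ℕ.* y)
    collect = ℕ-Solver.solve-∀
    double : ∀ x y → 4 ℕ.* ((x ℕ.+ x) ℕ.* y) ≡ 8 ℕ.* (x ℕ.* y)
    double = ℕ-Solver.solve-∀

  ∣b∣≤10 : ∣ b ∣ ℕ.≤ 10
  ∣b∣≤10 = ℕ.*-cancelʳ-≤ ∣ b ∣ 10 g₃ (begin
    ∣ b ∣ ℕ.* g₃                    ≡⟨ sym (abs-* b (F (3 ℕ.+ i))) ⟩
    ∣ b * F (3 ℕ.+ i) ∣             ≡⟨ cong ∣_∣ (isolate a b (F (2 ℕ.+ i)) (F (3 ℕ.+ i))) ⟩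
    ∣ P - a * F (2 ℕ.+ i) ∣         ≤⟨ ∣i-j∣≤∣i∣+∣j∣ P (a * F (2 ℕ.+ i)) ⟩
    ∣ P ∣ ℕ.+ ∣ a * F (2 ℕ.+ i) ∣   ≡⟨ cong (∣ P ∣ ℕ.+_) (abs-* a (F (2 ℕ.+ i))) ⟩
    ∣ P ∣ ℕ.+ ∣ a ∣ ℕ.* g₂          ≤⟨ ℕ.+-mono-≤ P≤ (ℕ.*-mono-≤ ∣a∣≤8 (fib-mono (2 ℕ.+ i))) ⟩
    2 ℕ.* g₃ ℕ.+ 8 ℕ.* g₃           ≡⟨ sym (ℕ.*-distribʳ-+ g₃ 2 8) ⟩
    10 ℕ.* g₃                       ∎)
    where
    open ℕ.≤-Reasoning
    isolate : ∀ a b y₂ y₃ → b * y₃ ≡ (a * y₂ + b * y₃) - a * y₂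
    isolate = solve-∀

requiredCarry-bounded : ∀ i xs → ∣ diffFrom i xs ∣ ℕ.≤ 2 ℕ.* fib (3 ℕ.+ i) → InBox (requiredCarry xs)
requiredCarry-bounded i xs D≤ = carry-bounded i (length xs) (requiredCarry xs) P≤ (dualValue-requiredCarry xs)
  where
  P≤ : ∣ carryValue i (requiredCarry xs) ∣ ℕ.≤ 2 ℕ.* fib (3 ℕ.+ i)
  P≤ = subst (ℕ._≤ 2 ℕ.* fib (3 ℕ.+ i))
             (trans (sym (∣-i∣≡∣i∣ (diffFrom i xs)))
                    (cong ∣_∣ (sym (inverseˡ-unique (carryValue i (requiredCarry xs)) (diffFrom i xs)
                                                      (requiredCarry-balances i xs)))))
             D≤

-- When diffFrom 0 w = 0, diffFrom i of the suffix after i letters is minus the contribution of the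
-- first i letters, of absolute value at most 2 (F(2) + ⋯ + F(i+1)) = 2 F(i+3) − 4.
SmallDiff : ℕ → List (Digit × Digit) → Set
SmallDiff i xs = 4 ℕ.+ ∣ diffFrom i xs ∣ ℕ.≤ 2 ℕ.* fib (3 ℕ.+ i)

smallDiff-start : ∀ w → diffFrom 0 w ≡ 0ℤ → SmallDiff 0 w
smallDiff-start w diff≡0 = subst (λ e → 4 ℕ.+ ∣ e ∣ ℕ.≤ 4) (sym diff≡0) ℕ.≤-refl

smallDiff-∷ : ∀ i x xs → SmallDiff i (x ∷ xs) → SmallDiff (suc i) xs
smallDiff-∷ i x xs small = begin
  4 ℕ.+ ∣ diffFrom (suc i) xs ∣                  ≡⟨ cong (λ e → 4 ℕ.+ ∣ e ∣) (peel d (diffFrom (suc i) xs)) ⟩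
  4 ℕ.+ ∣ D - d ∣                                ≤⟨ ℕ.+-monoʳ-≤ 4 (∣i-j∣≤∣i∣+∣j∣ D d) ⟩
  4 ℕ.+ (∣ D ∣ ℕ.+ ∣ d ∣)                        ≡⟨ sym (ℕ.+-assoc 4 ∣ D ∣ ∣ d ∣) ⟩
  4 ℕ.+ ∣ D ∣ ℕ.+ ∣ d ∣                          ≤⟨ ℕ.+-mono-≤ small (∣digitDiff*F∣≤ x (2 ℕ.+ i)) ⟩
  2 ℕ.* fib (3 ℕ.+ i) ℕ.+ 2 ℕ.* fib (2 ℕ.+ i)    ≡⟨ sym (ℕ.*-distribˡ-+ 2 (fib (3 ℕ.+ i)) (fib (2 ℕ.+ i))) ⟩
  2 ℕ.* fib (4 ℕ.+ i)                            ∎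
  where
  open ℕ.≤-Reasoning
  D = diffFrom i (x ∷ xs)
  d = digitDiff x * F (2 ℕ.+ i)
  peel : ∀ d e → e ≡ d + e - d
  peel = solve-∀

smallDiff-bound : ∀ i xs → SmallDiff i xs → ∣ diffFrom i xs ∣ ℕ.≤ 2 ℕ.* fib (3 ℕ.+ i)
smallDiff-bound i xs = ℕ.≤-trans (ℕ.m≤n+m ∣ diffFrom i xs ∣ 4)

-- Boxes of carries

toFin : ∀ {m} → ℤ → Maybe (Fin m)
toFin {m} (+ k) with k ℕ.<? m
... | yes k<m = just (fromℕ< k<m)
... | no  _   = nothing
toFin -[1+ _ ] = nothing

toFin-sound : ∀ {m} x {i : Fin m} → toFin x ≡ just i → + toℕ i ≡ x
toFin-sound {m} (+ k) eq with k ℕ.<? m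
toFin-sound (+ k) refl | yes k<m = cong +_ (toℕ-fromℕ< k<m)
toFin-sound (+ k) ()   | no  _
toFin-sound -[1+ _ ] ()

toFin-complete : ∀ {m} k → k ℕ.< m → ∃[ i ] toFin {m} (+ k) ≡ just i
toFin-complete {m} k k<m with k ℕ.<? m
... | yes k<m′ = fromℕ< k<m′ , refl
... | no  k≮m  = contradiction k<m k≮m

-- The integers −n, …, n, offset by n.
Interval : ℕ → Set
Interval n = Fin (suc (n ℕ.+ n))

toℤ : ∀ n → Interval n → ℤ
toℤ n i = + toℕ i - + n

toInterval : ∀ n → ℤ → Maybe (Interval n)
toInterval n x = toFin (x + + n)

toInterval-sound : ∀ n x {i} → toInterval n x ≡ just i → toℤ n i ≡ x
toInterval-sound n x eq = trans (cong (_- + n) (toFin-sound (x + + n) eq)) (cancel x (+ n))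
  where
  cancel : ∀ x y → x + y - y ≡ x
  cancel = solve-∀

toInterval-complete : ∀ n x → ∣ x ∣ ℕ.≤ n → ∃[ i ] toInterval n x ≡ just i
toInterval-complete n (+ m)    m≤n = toFin-complete (m ℕ.+ n) (s≤s (ℕ.+-monoˡ-≤ n m≤n))
toInterval-complete n -[1+ m ] m<n =
  subst (λ y → ∃[ i ] toFin {suc (n ℕ.+ n)} y ≡ just i) (sym (⊖-≥ m<n))
        (toFin-complete (n ℕ.∸ suc m) (s≤s (ℕ.≤-trans (ℕ.m∸n≤m n (suc m)) (ℕ.m≤m+n n n))))

Box : Set
Box = Interval 8 × Interval 10

carryOf : Box → ℤ × ℤ
carryOf (i , j) = toℤ 8 i , toℤ 10 j

toBox : ℤ × ℤ → Maybe Box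
toBox (a , b) = zip (toInterval 8 a) (toInterval 10 b)

toBox-sound : ∀ p {q} → toBox p ≡ just q → carryOf q ≡ p
toBox-sound (a , b) eq with toInterval 8 a in ea | toInterval 10 b in eb
toBox-sound (a , b) refl | just i  | just j  = cong₂ _,_ (toInterval-sound 8 a ea) (toInterval-sound 10 b eb)
toBox-sound (a , b) ()   | just _  | nothing
toBox-sound (a , b) ()   | nothing | _

toBox-complete : ∀ p → InBox p → ∃[ q ] toBox p ≡ just q
toBox-complete (a , b) (a≤8 , b≤10) with toInterval-complete 8 a a≤8 | toInterval-complete 10 b b≤10
... | i , ea | j , eb = (i , j) , cong₂ zip ea eb

boxStep : Maybe Box → Digit × Digit → Maybe Box
boxStep nothing  _ = nothing
boxStep (just q) x = toBox (carry (carryOf q) (digitDiff x))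

atOrigin : Maybe Box → Bool
atOrigin nothing  = false
atOrigin (just q) = does (≡-dec _≟ℤ_ _≟ℤ_ (carryOf q) (0ℤ , 0ℤ))

atOrigin-sound : ∀ q → atOrigin (just q) ≡ true → carryOf q ≡ (0ℤ , 0ℤ)
atOrigin-sound q acc with ≡-dec _≟ℤ_ _≟ℤ_ (carryOf q) (0ℤ , 0ℤ)
atOrigin-sound q acc | yes q≡0 = q≡0
atOrigin-sound q ()  | no  _

nothing-rejects : ∀ xs → ¬ atOrigin (foldl boxStep nothing xs) ≡ true
nothing-rejects []       ()
nothing-rejects (_ ∷ xs) = nothing-rejects xs

boxRun-sound : ∀ i q xs → atOrigin (foldl boxStep (just q) xs) ≡ true →
               carryValue i (carryOf q) + diffFrom i xs ≡ 0ℤ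
boxRun-sound i q []       acc = cong (λ p → carryValue i p + 0ℤ) (atOrigin-sound q acc)
boxRun-sound i q (x ∷ xs) acc with toBox (carry (carryOf q) (digitDiff x)) in eq
... | nothing = contradiction acc (nothing-rejects xs)
... | just q′ = begin
  carryValue i (carryOf q) + diffFrom i (x ∷ xs)                           ≡⟨ carryValue-step i (carryOf q) x xs ⟩
  carryValue (suc i) (carry (carryOf q) (digitDiff x)) + diffFrom (suc i) xs
    ≡⟨ cong (λ p → carryValue (suc i) p + diffFrom (suc i) xs) (sym (toBox-sound (carry (carryOf q) (digitDiff x)) eq)) ⟩
  carryValue (suc i) (carryOf q′) + diffFrom (suc i) xs                    ≡⟨ boxRun-sound (suc i) q′ xs acc ⟩
  0ℤ                                                                       ∎
  where open ≡-Reasoning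

boxRun-complete : ∀ i q xs → SmallDiff i xs → carryOf q ≡ requiredCarry xs →
                  atOrigin (foldl boxStep (just q) xs) ≡ true
boxRun-complete i q []       _     q≡0   = dec-true (≡-dec _≟ℤ_ _≟ℤ_ (carryOf q) (0ℤ , 0ℤ)) q≡0
boxRun-complete i q (x ∷ xs) small q≡req =
  let small′       = smallDiff-∷ i x xs small
      (q′ , q′-ok) = toBox-complete (requiredCarry xs) (requiredCarry-bounded (suc i) xs (smallDiff-bound (suc i) xs small′))
      step≡ : boxStep (just q) x ≡ just q′
      step≡ = trans (cong (λ p → toBox (carry p (digitDiff x))) q≡req)
                    (trans (cong toBox (carry-uncarry (requiredCarry xs) (digitDiff x))) q′-ok)
  in subst (λ s → atOrigin (foldl boxStep s xs) ≡ true) (sym step≡)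
           (boxRun-complete (suc i) q′ xs small′ (toBox-sound (requiredCarry xs) q′-ok))

balanced : ℤ → ℤ × ℤ
balanced v = - (+ 2 * v) , v

carryValue-balanced : ∀ v → carryValue 0 (balanced v) ≡ 0ℤ
carryValue-balanced v = identity v
  where
  identity : ∀ v → - (+ 2 * v) * + 1 + v * + 2 ≡ 0ℤ
  identity = solve-∀

balanced-unique : ∀ p → carryValue 0 p ≡ 0ℤ → p ≡ balanced (proj₂ p)
balanced-unique (a , b) a+2b≡0 = cong (_, b) (begin
  a                           ≡⟨ isolate a b ⟩
  a * + 1 + b * + 2 - + 2 * b ≡⟨ cong (_- + 2 * b) a+2b≡0 ⟩
  0ℤ - + 2 * b                ≡⟨ +-identityˡ (- (+ 2 * b)) ⟩
  - (+ 2 * b)                 ∎)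
  where
  open ≡-Reasoning
  isolate : ∀ a b → a ≡ a * + 1 + b * + 2 - + 2 * b
  isolate = solve-∀

∣balanced∣≤4 : ∀ v → InBox (balanced v) → ∣ v ∣ ℕ.≤ 4
∣balanced∣≤4 v (∣2v∣≤8 , _) = ℕ.*-cancelˡ-≤ 2 (subst (ℕ._≤ 8) (trans (∣-i∣≡∣i∣ (+ 2 * v)) (abs-* (+ 2) v)) ∣2v∣≤8)

-- The carries of value 0 at position 0 are the balanced v, and those in the box have |v| ≤ 4; the
-- value automaton runs the carry automaton from each of them.
startBox : Interval 4 → Maybe Box
startBox v = toBox (balanced (toℤ 4 v))

finiteCarryState : Finite (Maybe Box)
finiteCarryState = finiteMaybe (finite-× (finiteFin (suc (8 ℕ.+ 8))) (finiteFin (suc (10 ℕ.+ 10))))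

carryDFA : Maybe Box → DFA (Digit × Digit)
carryDFA s = automaton finiteCarryState s boxStep atOrigin

valueDFA : DFA (Digit × Digit)
valueDFA = ⋃ (carryDFA ∘ startBox)

startBox-sound : ∀ v w → atOrigin (foldl boxStep (startBox v) w) ≡ true → diffFrom 0 w ≡ 0ℤ
startBox-sound v w = sound (startBox v) refl
  where
  open ≡-Reasoning
  sound : ∀ s → startBox v ≡ s → atOrigin (foldl boxStep s w) ≡ true → diffFrom 0 w ≡ 0ℤ
  sound nothing  _  acc = contradiction acc (nothing-rejects w)
  sound (just q) eq acc = begin
    diffFrom 0 w                                      ≡⟨ sym (+-identityˡ (diffFrom 0 w)) ⟩
    0ℤ + diffFrom 0 w                                 ≡⟨ cong (_+ diffFrom 0 w) (sym (carryValue-balanced (toℤ 4 v))) ⟩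
    carryValue 0 (balanced (toℤ 4 v)) + diffFrom 0 w
      ≡⟨ cong (λ p → carryValue 0 p + diffFrom 0 w) (sym (toBox-sound (balanced (toℤ 4 v)) eq)) ⟩
    carryValue 0 (carryOf q) + diffFrom 0 w           ≡⟨ boxRun-sound 0 q w acc ⟩
    0ℤ                                                ∎

startBox-complete : ∀ p → carryValue 0 p ≡ 0ℤ → InBox p → ∃[ v ] startBox v ≡ toBox p
startBox-complete p p≡0 inBox
  with toInterval-complete 4 (proj₂ p) (∣balanced∣≤4 (proj₂ p) (subst InBox (balanced-unique p p≡0) inBox))
... | v , v-ok = v , trans (cong (toBox ∘ balanced) (toInterval-sound 4 (proj₂ p) v-ok))
                           (cong toBox (sym (balanced-unique p p≡0)))

valueDFA-sound : ∀ w → Accepts valueDFA w → diffFrom 0 w ≡ 0ℤ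
valueDFA-sound w acc =
  let (v , acc-v) = to (Accepts-⋃ (carryDFA ∘ startBox) w) acc
  in startBox-sound v w (to (Accepts-automaton finiteCarryState (startBox v) boxStep atOrigin w) acc-v)

valueDFA-complete : ∀ w → diffFrom 0 w ≡ 0ℤ → Accepts valueDFA w
valueDFA-complete w diff≡0 =
  let (v , start≡) = startBox-complete p p≡0 inBox
      (q , q-ok)   = toBox-complete p inBox
      accepts : atOrigin (foldl boxStep (startBox v) w) ≡ true
      accepts = subst (λ s → atOrigin (foldl boxStep s w) ≡ true) (sym (trans start≡ q-ok))
                      (boxRun-complete 0 q w small (toBox-sound p q-ok))
  in from (Accepts-⋃ (carryDFA ∘ startBox) w)
          (v , from (Accepts-automaton finiteCarryState (startBox v) boxStep atOrigin w) accepts)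
  where
  p = requiredCarry w
  small = smallDiff-start w diff≡0
  inBox = requiredCarry-bounded 0 w (smallDiff-bound 0 w small)
  p≡0 = trans (sym (+-identityʳ (carryValue 0 p)))
              (trans (cong (λ e → carryValue 0 p + e) (sym diff≡0)) (requiredCarry-balances 0 w))

valueDFA-correct : ∀ w → Accepts valueDFA w ⇔ (val (map proj₁ w) ≡ val (map proj₂ w))
valueDFA-correct w = ⇔-trans (mk⇔ (valueDFA-sound w) (valueDFA-complete w)) (⇔-sym (val≡val⇔diffFrom≡0 w))

mainTheorem3 : Σ (DFA (Digit × Digit)) λ M →
    ∀ (w : List (Digit × Digit)) →
      Accepts M w ⇔ (IsChungGraham (map proj₂ w) × val (map proj₁ w) ≡ val (map proj₂ w))
mainTheorem3 = comap proj₂ chungGrahamDFA ∩ valueDFA , λ w →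
  ⇔-trans (Accepts-∩ (comap proj₂ chungGrahamDFA) valueDFA w)
          (⇔-trans (Accepts-comap proj₂ chungGrahamDFA w) (chungGrahamDFA-correct (map proj₂ w))
           ×-⇔ valueDFA-correct w)
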